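{- Let $k\ge 2$ and $N\ge 2$ be integers, let $T_{\mathrm{count}}$ be the Holte count matrix of $k$-summand base-$N$ addition and $\widetilde{T}_{\mathrm{count}}$ its leading $(k-1)\times(k-1)$ principal submatrix (indices $0,\ldots,k-2$). Then \[ \det(\widetilde{T}_{\mathrm{count}}) = \frac{N^{\binom{k}{2}}}{k!}\prod_{i=1}^{k-1}(iN+1). \]
   Context: Let $d_1,\ldots,d_k$ range over $\{0,\ldots,N-1\}$. The Holte count matrix is the $k\times k$ matrix with $T_{\mathrm{count}}[c',c] = \#\{(d_1,\ldots,d_k)\in\{0,\ldots,N-1\}^k : \lfloor (d_1+\cdots+d_k+c)/N\rfloor = c'\}$ for $c,c'\in\{0,\ldots,k-1\}$. -}

module Defs where

open import Data.Nat using (ℕ; zero; suc; _+_; _*_; _∸_; NonZero)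
open import Data.Nat.DivMod using (_/_)
open import Data.Nat.Properties using (_≟_)
open import Data.Fin using (Fin; zero; suc; toℕ; punchIn)
open import Data.Integer as ℤ using (ℤ; +_; -_)
open import Data.List using (List; []; _∷_; map; concatMap; filter; length; upTo)
open import Data.Nat.ListAction using (product)
open import Data.Vec as V using (Vec; []; _∷_)

tuples : (k N : ℕ) → List (Vec ℕ k)
tuples zero    N = [] ∷ []
tuples (suc k) N = concatMap (λ d → map (d ∷_) (tuples k N)) (upTo N)

Tcount : (k N : ℕ) .{{_ : NonZero N}} → (c' c : ℕ) → ℕ
Tcount k N c' c = length (filter (λ d → ((V.sum d + c) / N) ≟ c') (tuples k N))

Ttilde : (k N : ℕ) .{{_ : NonZero N}} → Fin (k ∸ 1) → Fin (k ∸ 1) → ℤ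
Ttilde k N i j = + Tcount k N (toℕ i) (toℕ j)

sumFin : ∀ n → (Fin n → ℤ) → ℤ
sumFin zero    f = + 0
sumFin (suc n) f = f zero ℤ.+ sumFin n (λ i → f (suc i))

sign : ℕ → ℤ
sign zero    = + 1
sign (suc n) = - sign n

det : ∀ n → (Fin n → Fin n → ℤ) → ℤ
det zero    M = + 1
det (suc n) M =
  sumFin (suc n) (λ j → sign (toℕ j) ℤ.* (M zero j ℤ.* det n (λ r c → M (suc r) (punchIn j c))))

prodTerm : (k N : ℕ) → ℕ
prodTerm k N = product (map (λ i → suc i * N + 1) (upTo (k ∸ 1)))

-- Let n = k - 1 and x_j = (j + 1) N. Sorting the tuples d by the quotient
-- q = ⌊(d₁ + ⋯ + d_k + c) / N⌋, and writing each x ∈ ℕᵏ as x = d + N y with d ∈ [0, N)ᵏ,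
-- shows that Σ_{i ≤ j} C(j - i + k, k) T[i][c] = #{x ∈ ℕᵏ : x₁ + ⋯ + x_k + c < x_j}
-- = C(x_j + n - c, k); so a lower unitriangular row operation turns T̃ into [C(x_j + n - c, k)].
-- By Vandermonde's identity this matrix is an upper unitriangular column operation away from
-- [C(x_j + 1, c + 2)]. Absorbing (c + 1)(c + 2) into column c and x_j (x_j + 1) into row j
-- leaves [C(x_j - 1, c)], which Pascal's rule reduces by column operations to [C(j N, c)]. Its
-- first row is (1, 0, …, 0), and absorbing c + 1 and (j + 1) N in its minor gives back the
-- previous shape one size smaller, so its determinant is N^C(n, 2). Collecting the factors,
-- det T̃ · n! · k! = n! · N^C(k, 2) · ∏_{i=1}^{n} (i N + 1).

module Submission where

open import Defs
open import Data.Nat as ℕ using (ℕ; zero; suc; z≤n; s≤s)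
open import Function using (_∘_)
open import Relation.Nullary using (yes; no; contradiction)
open import Relation.Binary.PropositionalEquality
open ≡-Reasoning

-- Finite sums and products over ℕ

module _ where

  open import Data.Nat using (_+_; _*_; _^_; _!)
  open import Data.Nat.Properties
  open import Data.List using (applyUpTo)
  open import Data.Nat.ListAction using (sum; product)
  open import Algebra.Properties.CommutativeSemigroup +-commutativeSemigroup
    using () renaming (interchange to +-interchange)
  open import Algebra.Properties.CommutativeSemigroup *-commutativeSemigroup
    using () renaming (interchange to *-interchange)

  ∑ℕ : ℕ → (ℕ → ℕ) → ℕ
  ∑ℕ n f = sum (applyUpTo f n)

  syntax ∑ℕ n (λ i → e) = ∑ℕ[ i < n ] e

  ∏ℕ : ℕ → (ℕ → ℕ) → ℕ
  ∏ℕ n f = product (applyUpTo f n)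

  syntax ∏ℕ n (λ i → e) = ∏ℕ[ i < n ] e

  ∑ℕ-cong : ∀ n {f g : ℕ → ℕ} → (∀ i → f i ≡ g i) → ∑ℕ n f ≡ ∑ℕ n g
  ∑ℕ-cong zero    eq = refl
  ∑ℕ-cong (suc n) eq = cong₂ _+_ (eq 0) (∑ℕ-cong n (eq ∘ suc))

  ∑ℕ-zero : ∀ n → ∑ℕ[ i < n ] 0 ≡ 0
  ∑ℕ-zero zero    = refl
  ∑ℕ-zero (suc n) = ∑ℕ-zero n

  ∑ℕ-distrib-+ : ∀ n (f g : ℕ → ℕ) → ∑ℕ[ i < n ] (f i + g i) ≡ ∑ℕ n f + ∑ℕ n g
  ∑ℕ-distrib-+ zero    f g = refl
  ∑ℕ-distrib-+ (suc n) f g = begin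
    f 0 + g 0 + ∑ℕ[ i < n ] (f (suc i) + g (suc i))
      ≡⟨ cong (f 0 + g 0 +_) (∑ℕ-distrib-+ n (f ∘ suc) (g ∘ suc)) ⟩
    f 0 + g 0 + (∑ℕ n (f ∘ suc) + ∑ℕ n (g ∘ suc))
      ≡⟨ +-interchange (f 0) (g 0) (∑ℕ n (f ∘ suc)) (∑ℕ n (g ∘ suc)) ⟩
    f 0 + ∑ℕ n (f ∘ suc) + (g 0 + ∑ℕ n (g ∘ suc)) ∎

  ∑ℕ-comm : ∀ m n (f : ℕ → ℕ → ℕ) → ∑ℕ[ i < m ] ∑ℕ[ j < n ] f i j ≡ ∑ℕ[ j < n ] ∑ℕ[ i < m ] f i j
  ∑ℕ-comm zero    n f = sym (∑ℕ-zero n)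
  ∑ℕ-comm (suc m) n f = begin
    ∑ℕ n (f 0) + ∑ℕ[ i < m ] ∑ℕ[ j < n ] f (suc i) j
      ≡⟨ cong (∑ℕ n (f 0) +_) (∑ℕ-comm m n (f ∘ suc)) ⟩
    ∑ℕ n (f 0) + ∑ℕ[ j < n ] ∑ℕ[ i < m ] f (suc i) j
      ≡⟨ ∑ℕ-distrib-+ n (f 0) _ ⟨
    ∑ℕ[ j < n ] (f 0 j + ∑ℕ[ i < m ] f (suc i) j) ∎

  ∑ℕ-split : ∀ m n (f : ℕ → ℕ) → ∑ℕ (m + n) f ≡ ∑ℕ m f + ∑ℕ[ i < n ] f (m + i)
  ∑ℕ-split zero    n f = refl
  ∑ℕ-split (suc m) n f = trans (cong (f 0 +_) (∑ℕ-split m n (f ∘ suc))) (sym (+-assoc (f 0) _ _))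

  ∑ℕ-blocks : ∀ a N (f : ℕ → ℕ) → ∑ℕ (a * N) f ≡ ∑ℕ[ i < a ] ∑ℕ[ d < N ] f (i * N + d)
  ∑ℕ-blocks zero    N f = refl
  ∑ℕ-blocks (suc a) N f = begin
    ∑ℕ (N + a * N) f
      ≡⟨ ∑ℕ-split N (a * N) f ⟩
    ∑ℕ N f + ∑ℕ[ v < a * N ] f (N + v)
      ≡⟨ cong (∑ℕ N f +_) (∑ℕ-blocks a N (λ v → f (N + v))) ⟩
    ∑ℕ N f + ∑ℕ[ i < a ] ∑ℕ[ d < N ] f (N + (i * N + d))
      ≡⟨ cong (∑ℕ N f +_) (∑ℕ-cong a (λ i → ∑ℕ-cong N (λ d → cong f (sym (+-assoc N (i * N) d))))) ⟩
    ∑ℕ N f + ∑ℕ[ i < a ] ∑ℕ[ d < N ] f (suc i * N + d) ∎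

  ∏ℕ-distrib-* : ∀ n (f g : ℕ → ℕ) → ∏ℕ[ i < n ] (f i * g i) ≡ ∏ℕ n f * ∏ℕ n g
  ∏ℕ-distrib-* zero    f g = refl
  ∏ℕ-distrib-* (suc n) f g = begin
    f 0 * g 0 * ∏ℕ[ i < n ] (f (suc i) * g (suc i))
      ≡⟨ cong (f 0 * g 0 *_) (∏ℕ-distrib-* n (f ∘ suc) (g ∘ suc)) ⟩
    f 0 * g 0 * (∏ℕ n (f ∘ suc) * ∏ℕ n (g ∘ suc))
      ≡⟨ *-interchange (f 0) (g 0) (∏ℕ n (f ∘ suc)) (∏ℕ n (g ∘ suc)) ⟩
    f 0 * ∏ℕ n (f ∘ suc) * (g 0 * ∏ℕ n (g ∘ suc)) ∎

  ∏ℕ-const : ∀ n a → ∏ℕ[ i < n ] a ≡ a ^ n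
  ∏ℕ-const zero    a = refl
  ∏ℕ-const (suc n) a = cong (a *_) (∏ℕ-const n a)

  ∏ℕ-init-last : ∀ n (f : ℕ → ℕ) → ∏ℕ (suc n) f ≡ ∏ℕ n f * f n
  ∏ℕ-init-last zero    f = *-comm (f 0) 1
  ∏ℕ-init-last (suc n) f = trans (cong (f 0 *_) (∏ℕ-init-last n (f ∘ suc))) (sym (*-assoc (f 0) _ _))

  ∏ℕ-suc : ∀ n → ∏ℕ n suc ≡ n !
  ∏ℕ-suc zero    = refl
  ∏ℕ-suc (suc n) = begin
    ∏ℕ (suc n) suc    ≡⟨ ∏ℕ-init-last n suc ⟩
    ∏ℕ n suc * suc n  ≡⟨ cong (_* suc n) (∏ℕ-suc n) ⟩
    n ! * suc n       ≡⟨ *-comm (n !) (suc n) ⟩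
    suc n !           ∎

  ∏ℕ-cong : ∀ n {f g : ℕ → ℕ} → (∀ i → f i ≡ g i) → ∏ℕ n f ≡ ∏ℕ n g
  ∏ℕ-cong zero    eq = refl
  ∏ℕ-cong (suc n) eq = cong₂ _*_ (eq 0) (∏ℕ-cong n (eq ∘ suc))

  ∏ℕ-multiples : ∀ n N → ∏ℕ[ r < n ] (suc r * N) ≡ n ! * N ^ n
  ∏ℕ-multiples n N = trans (∏ℕ-distrib-* n suc (λ _ → N)) (cong₂ _*_ (∏ℕ-suc n) (∏ℕ-const n N))

  ∏ℕ-consecutive : ∀ n → ∏ℕ[ c < n ] (suc c * suc (suc c)) ≡ n ! * suc n !
  ∏ℕ-consecutive n = begin
    ∏ℕ[ c < n ] (suc c * suc (suc c))  ≡⟨ ∏ℕ-distrib-* n suc (λ c → suc (suc c)) ⟩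
    ∏ℕ n suc * ∏ℕ[ c < n ] suc (suc c)  ≡⟨ cong₂ _*_ (∏ℕ-suc n) (trans (sym (*-identityˡ _)) (∏ℕ-suc (suc n))) ⟩
    n ! * suc n !                       ∎

-- Determinants

module _ where

  import Data.Nat.Properties as ℕ
  open import Data.Fin as Fin using (Fin; zero; suc; toℕ; punchIn; opposite)
  open import Data.Fin.Properties using (toℕ<n; toℕ-injective; any?; punchInᵢ≢i; opposite-prop; opposite-involutive)
  open import Data.Integer as ℤ using (ℤ; +_; -_; _+_; _*_; _-_)
  import Data.Integer.Properties as ℤ
  open import Data.Integer.Tactic.RingSolver using (solve-∀)
  open import Algebra.Properties.Semiring.Sum ℤ.+-*-semiring
    using (sum; sum-syntax; sum-cong-≗; ∑-distrib-+; ∑-comm; *-distribˡ-sum; *-distribʳ-sum; sum-remove; sum-replicate-zero)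
  open import Data.Vec.Functional using (updateAt)
  open import Data.Vec.Functional.Properties using (updateAt-updates; updateAt-minimal; updateAt-id-local; map-updateAt-local)
  open import Data.Product using (_,_)
  open import Function using (const)
  open import Function.Definitions using (Congruent; Injective)

  Matrix : ℕ → Set
  Matrix n = Fin n → Fin n → ℤ

  minor : ∀ {n} → Matrix (suc n) → Fin (suc n) → Matrix n
  minor M j r c = M (suc r) (punchIn j c)

  _ᵀ : ∀ {n} → Matrix n → Matrix n
  (M ᵀ) i j = M j i

  _[_]≔_ : ∀ {n} → Matrix n → Fin n → (Fin n → ℤ) → Matrix n
  M [ t ]≔ v = updateAt M t (const v)

  ∑-zero : ∀ {n} (f : Fin n → ℤ) → (∀ i → f i ≡ + 0) → ∑[ i < n ] f i ≡ + 0
  ∑-zero {n} f f≡0 = trans (sum-cong-≗ f≡0) (sum-replicate-zero n)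

  ∑-neg : ∀ {n} (f : Fin n → ℤ) → ∑[ i < n ] (- f i) ≡ - ∑[ i < n ] f i
  ∑-neg f = begin
    ∑[ i < _ ] (- f i)          ≡⟨ sum-cong-≗ (λ i → sym (ℤ.-1*i≡-i (f i))) ⟩
    ∑[ i < _ ] (ℤ.-1ℤ * f i)    ≡⟨ *-distribˡ-sum ℤ.-1ℤ f ⟨
    ℤ.-1ℤ * ∑[ i < _ ] f i      ≡⟨ ℤ.-1*i≡-i _ ⟩
    - ∑[ i < _ ] f i            ∎

  ∑-single : ∀ {n} (t : Fin n) (f : Fin n → ℤ) → (∀ i → i ≢ t → f i ≡ + 0) → ∑[ i < n ] f i ≡ f t
  ∑-single {suc n} t f f≡0 = begin
    sum f                     ≡⟨ sum-remove {i = t} f ⟩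
    f t + sum (f ∘ punchIn t) ≡⟨ cong (λ z → f t + z) (∑-zero _ (λ i → f≡0 _ (punchInᵢ≢i t i))) ⟩
    f t + + 0                 ≡⟨ ℤ.+-identityʳ (f t) ⟩
    f t                       ∎

  sumFin≡∑ : ∀ n (f : Fin n → ℤ) → sumFin n f ≡ ∑[ i < n ] f i
  sumFin≡∑ zero    f = refl
  sumFin≡∑ (suc n) f = cong (λ z → f zero + z) (sumFin≡∑ n (f ∘ suc))

  det-expand : ∀ {n} (M : Matrix (suc n)) →
    det (suc n) M ≡ ∑[ j < suc n ] (sign (toℕ j) * (M zero j * det n (minor M j)))
  det-expand {n} M = sumFin≡∑ (suc n) (λ j → sign (toℕ j) * (M zero j * det n (minor M j)))

  det-cong : ∀ {n} {M M′ : Matrix n} → (∀ i j → M i j ≡ M′ i j) → det n M ≡ det n M′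
  det-cong {zero}          eq = refl
  det-cong {suc n} {M} {M′} eq = trans (det-expand M) (trans (sum-cong-≗ term) (sym (det-expand M′)))
    where
    term : ∀ j → sign (toℕ j) * (M zero j * det n (minor M j)) ≡ sign (toℕ j) * (M′ zero j * det n (minor M′ j))
    term j = cong₂ (λ a d → sign (toℕ j) * (a * d)) (eq zero j) (det-cong (λ r c → eq (suc r) (punchIn j c)))


  ∑-neg-swap : ∀ {m n} (p a : Fin m → ℤ) (q b : Fin n → ℤ) (D : Fin n → Fin m → ℤ) →
    ∑[ i < m ] ((- p i) * (a i * ∑[ j < n ] (q j * (b j * D j i)))) ≡
    ∑[ j < n ] ((- q j) * (b j * ∑[ i < m ] (p i * (a i * D j i))))
  ∑-neg-swap {m} {n} p a q b D = begin
    ∑[ i < m ] ((- p i) * (a i * ∑[ j < n ] (q j * (b j * D j i))))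
      ≡⟨ sum-cong-≗ (λ i → pushˡ (- p i) (a i) (λ j → q j * (b j * D j i))) ⟩
    ∑[ i < m ] ∑[ j < n ] ((- p i) * (a i * (q j * (b j * D j i))))
      ≡⟨ ∑-comm (λ i j → (- p i) * (a i * (q j * (b j * D j i)))) ⟩
    ∑[ j < n ] ∑[ i < m ] ((- p i) * (a i * (q j * (b j * D j i))))
      ≡⟨ sum-cong-≗ (λ j → sum-cong-≗ (λ i → exchange (p i) (a i) (q j) (b j) (D j i))) ⟩
    ∑[ j < n ] ∑[ i < m ] ((- q j) * (b j * (p i * (a i * D j i))))
      ≡⟨ sum-cong-≗ (λ j → sym (pushˡ (- q j) (b j) (λ i → p i * (a i * D j i)))) ⟩
    ∑[ j < n ] ((- q j) * (b j * ∑[ i < m ] (p i * (a i * D j i)))) ∎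
    where
    pushˡ : ∀ {k} (x y : ℤ) (f : Fin k → ℤ) → x * (y * sum f) ≡ ∑[ i < k ] (x * (y * f i))
    pushˡ x y f = trans (cong (x *_) (*-distribˡ-sum y f)) (*-distribˡ-sum x (λ i → y * f i))
    exchange : ∀ p a q b d → (- p) * (a * (q * (b * d))) ≡ (- q) * (b * (p * (a * d)))
    exchange = solve-∀

  det-expandFirstColumn : ∀ {n} (M : Matrix (suc n)) →
    det (suc n) M ≡ ∑[ r < suc n ] (sign (toℕ r) * (M r zero * det n (λ i c → M (punchIn r i) (suc c))))
  det-expandFirstColumn {zero}  M = det-expand {zero} M
  det-expandFirstColumn {suc n} M = begin
    det (suc (suc n)) M
      ≡⟨ det-expand M ⟩
    corner + ∑[ j < suc n ] ((- sign (toℕ j)) * (M zero (suc j) * det (suc n) (minor M (suc j))))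
      ≡⟨ cong (λ z → corner + z) (sum-cong-≗ (λ j → cong (λ d → (- sign (toℕ j)) * (M zero (suc j) * d))
           (det-expandFirstColumn (minor M (suc j))))) ⟩
    corner + ∑[ j < suc n ] ((- sign (toℕ j)) * (M zero (suc j) *
               ∑[ r < suc n ] (sign (toℕ r) * (M (suc r) zero * det n (D r j)))))
      ≡⟨ cong (λ z → corner + z)
           (∑-neg-swap (sign ∘ toℕ) (M zero ∘ suc) (sign ∘ toℕ) (λ r → M (suc r) zero) (λ r j → det n (D r j))) ⟩
    corner + ∑[ r < suc n ] ((- sign (toℕ r)) * (M (suc r) zero *
               ∑[ j < suc n ] (sign (toℕ j) * (M zero (suc j) * det n (D r j)))))
      ≡⟨ cong (λ z → corner + z) (sum-cong-≗ (λ r → cong (λ d → (- sign (toℕ r)) * (M (suc r) zero * d))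
           (sym (det-expand (λ i c → M (punchIn (suc r) i) (suc c)))))) ⟩
    ∑[ r < suc (suc n) ] (sign (toℕ r) * (M r zero * det (suc n) (λ i c → M (punchIn r i) (suc c)))) ∎
    where
    corner : ℤ
    corner = + 1 * (M zero zero * det (suc n) (λ r c → M (suc r) (suc c)))
    D : Fin (suc n) → Fin (suc n) → Matrix n
    D r j i c = M (suc (punchIn r i)) (suc (punchIn j c))

  det-transpose : ∀ {n} (M : Matrix n) → det n (M ᵀ) ≡ det n M
  det-transpose {zero}  M = refl
  det-transpose {suc n} M = begin
    det (suc n) (M ᵀ)
      ≡⟨ det-expand (M ᵀ) ⟩
    ∑[ j < suc n ] (sign (toℕ j) * (M j zero * det n ((λ i c → M (punchIn j i) (suc c)) ᵀ)))
      ≡⟨ sum-cong-≗ (λ j → cong (λ d → sign (toℕ j) * (M j zero * d)) (det-transpose (λ i c → M (punchIn j i) (suc c)))) ⟩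
    ∑[ j < suc n ] (sign (toℕ j) * (M j zero * det n (λ i c → M (punchIn j i) (suc c))))
      ≡⟨ det-expandFirstColumn M ⟨
    det (suc n) M ∎

  det-scaleRows : ∀ {n} (v : ℕ → ℕ) (M : Matrix n) →
    det n (λ i j → + v (toℕ i) * M i j) ≡ + ∏ℕ n v * det n M
  det-scaleRows {zero}  v M = refl
  det-scaleRows {suc n} v M = begin
    det (suc n) (λ i j → + v (toℕ i) * M i j)
      ≡⟨ det-expand (λ i j → + v (toℕ i) * M i j) ⟩
    ∑[ j < suc n ] (sign (toℕ j) * ((+ v 0 * M zero j) * det n (λ r c → + v (suc (toℕ r)) * minor M j r c)))
      ≡⟨ sum-cong-≗ (λ j → cong (λ d → sign (toℕ j) * ((+ v 0 * M zero j) * d)) (det-scaleRows (v ∘ suc) (minor M j))) ⟩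
    ∑[ j < suc n ] (sign (toℕ j) * ((+ v 0 * M zero j) * (+ ∏ℕ n (v ∘ suc) * det n (minor M j))))
      ≡⟨ sum-cong-≗ (λ j → factor (sign (toℕ j)) (+ v 0) (M zero j) (+ ∏ℕ n (v ∘ suc)) (det n (minor M j))) ⟩
    ∑[ j < suc n ] (+ v 0 * + ∏ℕ n (v ∘ suc) * (sign (toℕ j) * (M zero j * det n (minor M j))))
      ≡⟨ *-distribˡ-sum (+ v 0 * + ∏ℕ n (v ∘ suc)) (λ j → sign (toℕ j) * (M zero j * det n (minor M j))) ⟨
    + v 0 * + ∏ℕ n (v ∘ suc) * ∑[ j < suc n ] (sign (toℕ j) * (M zero j * det n (minor M j)))
      ≡⟨ cong₂ _*_ (sym (ℤ.pos-* (v 0) _)) (sym (det-expand M)) ⟩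
    + ∏ℕ (suc n) v * det (suc n) M ∎
    where
    factor : ∀ s x m p d → s * ((x * m) * (p * d)) ≡ x * p * (s * (m * d))
    factor = solve-∀

  det-scaleCols : ∀ {n} (w : ℕ → ℕ) (M : Matrix n) →
    det n (λ i j → M i j * + w (toℕ j)) ≡ + ∏ℕ n w * det n M
  det-scaleCols {n} w M = begin
    det n (λ i j → M i j * + w (toℕ j))   ≡⟨ det-transpose (λ i j → M i j * + w (toℕ j)) ⟨
    det n (λ i j → M j i * + w (toℕ i))   ≡⟨ det-cong (λ i j → ℤ.*-comm (M j i) _) ⟩
    det n (λ i j → + w (toℕ i) * M j i)   ≡⟨ det-scaleRows w (M ᵀ) ⟩
    + ∏ℕ n w * det n (M ᵀ)                ≡⟨ cong (+ ∏ℕ n w *_) (det-transpose M) ⟩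
    + ∏ℕ n w * det n M                    ∎

  det-unitFirstRow : ∀ {n} (M : Matrix (suc n)) → M zero zero ≡ + 1 → (∀ c → M zero (suc c) ≡ + 0) →
    det (suc n) M ≡ det n (minor M zero)
  det-unitFirstRow {n} M corner≡1 row≡0 = begin
    det (suc n) M
      ≡⟨ det-expand M ⟩
    + 1 * (M zero zero * det n (minor M zero)) + ∑[ c < n ] ((- sign (toℕ c)) * (M zero (suc c) * det n (minor M (suc c))))
      ≡⟨ cong₂ _+_ (cong (λ a → + 1 * (a * det n (minor M zero))) corner≡1)
           (∑-zero (λ c → (- sign (toℕ c)) * (M zero (suc c) * det n (minor M (suc c))))
                   (λ c → trans (cong (λ a → (- sign (toℕ c)) * (a * det n (minor M (suc c)))) (row≡0 c))
                                  (zeroʳ (- sign (toℕ c)) (det n (minor M (suc c)))))) ⟩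
    + 1 * (+ 1 * det n (minor M zero)) + + 0
      ≡⟨ unit (det n (minor M zero)) ⟩
    det n (minor M zero) ∎
    where
    zeroʳ : ∀ s d → s * (+ 0 * d) ≡ + 0
    zeroʳ = solve-∀
    unit : ∀ d → + 1 * (+ 1 * d) + + 0 ≡ d
    unit = solve-∀


  -- Laplace expansion along the first two rows, a and b; F g stands for the minor of the
  -- remaining rows on the columns picked by g.
  expand₂ : ∀ p → (a b : Fin (suc (suc p)) → ℤ) → ((Fin p → Fin (suc (suc p))) → ℤ) → ℤ
  expand₂ p a b F =
    ∑[ j < suc (suc p) ] (sign (toℕ j) * (a j * ∑[ l < suc p ] (sign (toℕ l) * (b (punchIn j l) * F (punchIn j ∘ punchIn l)))))

  det-expand₂ : ∀ {p} (M : Matrix (suc (suc p))) →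
    det (suc (suc p)) M ≡ expand₂ p (M zero) (M (suc zero)) (λ g → det p (λ r c → M (suc (suc r)) (g c)))
  det-expand₂ {p} M = trans (det-expand M)
    (sum-cong-≗ (λ j → cong (λ d → sign (toℕ j) * (M zero j * d)) (det-expand (minor M j))))

  crossTerm : ∀ p → (Fin (suc (suc p)) → ℤ) → ((Fin p → Fin (suc (suc p))) → ℤ) → ℤ
  crossTerm p a F = ∑[ l < suc p ] (sign (toℕ l) * (a (suc l) * F (suc ∘ punchIn l)))

  restTerm : ∀ p → (a b : Fin (suc (suc p)) → ℤ) → ((Fin p → Fin (suc (suc p))) → ℤ) → ℤ
  restTerm p a b F = ∑[ j < suc p ] (sign (toℕ j) * (a (suc j) *
    ∑[ l < p ] (sign (toℕ l) * (b (suc (punchIn j l)) * F (punchIn (suc j) ∘ punchIn (suc l))))))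

  expand₂-split : ∀ p a b F →
    expand₂ p a b F ≡ a zero * crossTerm p b F - b zero * crossTerm p a F + restTerm p a b F
  expand₂-split p a b F = begin
    expand₂ p a b F
      ≡⟨ cong (λ z → + 1 * (a zero * crossTerm p b F) + z) (sum-cong-≗ (λ j →
           cong (λ z → (- sign (toℕ j)) * (a (suc j) * (+ 1 * (b zero * F (suc ∘ punchIn j)) + z)))
             (trans (sum-cong-≗ (λ l → sym (ℤ.neg-distribˡ-* (sign (toℕ l)) (innerFactor j l)))) (∑-neg (inner j))))) ⟩
    + 1 * (a zero * crossTerm p b F) + ∑[ j < suc p ] ((- sign (toℕ j)) *
        (a (suc j) * (+ 1 * (b zero * F (suc ∘ punchIn j)) + - ∑[ l < p ] inner j l)))
      ≡⟨ cong (λ z → + 1 * (a zero * crossTerm p b F) + z) (sum-cong-≗ (λ j →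
           regroup (sign (toℕ j)) (a (suc j)) (b zero) (F (suc ∘ punchIn j)) (∑[ l < p ] inner j l))) ⟩
    + 1 * (a zero * crossTerm p b F) + ∑[ j < suc p ] (- (b zero * u j) + v j)
      ≡⟨ cong (λ z → + 1 * (a zero * crossTerm p b F) + z) (begin
           ∑[ j < suc p ] (- (b zero * u j) + v j)
             ≡⟨ ∑-distrib-+ (λ j → - (b zero * u j)) v ⟩
           ∑[ j < suc p ] (- (b zero * u j)) + restTerm p a b F
             ≡⟨ cong (λ z → z + restTerm p a b F) (trans (∑-neg (λ j → b zero * u j))
                  (cong -_ (sym (*-distribˡ-sum (b zero) u)))) ⟩
           - (b zero * crossTerm p a F) + restTerm p a b F ∎) ⟩
    + 1 * (a zero * crossTerm p b F) + (- (b zero * crossTerm p a F) + restTerm p a b F)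
      ≡⟨ reassociate (a zero * crossTerm p b F) (b zero * crossTerm p a F) (restTerm p a b F) ⟩
    a zero * crossTerm p b F - b zero * crossTerm p a F + restTerm p a b F ∎
    where
    innerFactor inner : Fin (suc p) → Fin p → ℤ
    innerFactor j l = b (suc (punchIn j l)) * F (punchIn (suc j) ∘ punchIn (suc l))
    inner j l = sign (toℕ l) * innerFactor j l
    u v : Fin (suc p) → ℤ
    u j = sign (toℕ j) * (a (suc j) * F (suc ∘ punchIn j))
    v j = sign (toℕ j) * (a (suc j) * ∑[ l < p ] inner j l)
    regroup : ∀ s x y f r → (- s) * (x * (+ 1 * (y * f) + - r)) ≡ - (y * (s * (x * f))) + s * (x * r)
    regroup = solve-∀
    reassociate : ∀ x y r → + 1 * x + (- y + r) ≡ x - y + r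
    reassociate = solve-∀

  restTerm-lift : ∀ p a b (F : (Fin (suc p) → Fin (suc (suc (suc p)))) → ℤ) → Congruent _≗_ _≡_ F →
    restTerm (suc p) a b F ≡ expand₂ p (a ∘ suc) (b ∘ suc) (F ∘ Fin.lift 1)
  restTerm-lift p a b F F-cong = sum-cong-≗ (λ j → cong (λ z → sign (toℕ j) * (a (suc j) * z))
    (sum-cong-≗ (λ l → cong (λ z → sign (toℕ l) * (b (suc (punchIn j l)) * z))
      (F-cong {punchIn (suc j) ∘ punchIn (suc l)} {Fin.lift 1 (punchIn j ∘ punchIn l)}
        (λ { zero → refl ; (suc c) → refl })))))

  -- The terms in which a or b uses column 0 cancel against those of the swapped expansion;
  -- the others form the same expansion on the columns ≥ 1.
  expand₂-antisym : ∀ p a b F → Congruent _≗_ _≡_ F → expand₂ p a b F + expand₂ p b a F ≡ + 0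
  restTerm-antisym : ∀ p a b F → Congruent _≗_ _≡_ F → restTerm p a b F + restTerm p b a F ≡ + 0

  expand₂-antisym p a b F F-cong = begin
    expand₂ p a b F + expand₂ p b a F
      ≡⟨ cong₂ _+_ (expand₂-split p a b F) (expand₂-split p b a F) ⟩
    (a zero * crossTerm p b F - b zero * crossTerm p a F + restTerm p a b F) +
    (b zero * crossTerm p a F - a zero * crossTerm p b F + restTerm p b a F)
      ≡⟨ cancel (a zero * crossTerm p b F) (b zero * crossTerm p a F) (restTerm p a b F) (restTerm p b a F) ⟩
    restTerm p a b F + restTerm p b a F
      ≡⟨ restTerm-antisym p a b F F-cong ⟩
    + 0 ∎
    where
    cancel : ∀ x y r r′ → (x - y + r) + (y - x + r′) ≡ r + r′
    cancel = solve-∀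

  restTerm-antisym zero    a b F F-cong = empty (a (suc zero)) (b (suc zero))
    where
    empty : ∀ x y → + 1 * (x * + 0) + + 0 + (+ 1 * (y * + 0) + + 0) ≡ + 0
    empty = solve-∀
  restTerm-antisym (suc p) a b F F-cong = begin
    restTerm (suc p) a b F + restTerm (suc p) b a F
      ≡⟨ cong₂ _+_ (restTerm-lift p a b F F-cong) (restTerm-lift p b a F F-cong) ⟩
    expand₂ p (a ∘ suc) (b ∘ suc) (F ∘ Fin.lift 1) + expand₂ p (b ∘ suc) (a ∘ suc) (F ∘ Fin.lift 1)
      ≡⟨ expand₂-antisym p (a ∘ suc) (b ∘ suc) (F ∘ Fin.lift 1)
           (λ g≗h → F-cong (λ { zero → refl ; (suc c) → cong suc (g≗h c) })) ⟩
    + 0 ∎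

  swap₀₁ : ∀ {p} → Fin (suc (suc p)) → Fin (suc (suc p))
  swap₀₁ zero          = suc zero
  swap₀₁ (suc zero)    = zero
  swap₀₁ (suc (suc i)) = suc (suc i)

  det-swap₀₁ : ∀ {p} (M : Matrix (suc (suc p))) → det (suc (suc p)) (M ∘ swap₀₁) + det (suc (suc p)) M ≡ + 0
  det-swap₀₁ {p} M = trans (cong₂ _+_ (det-expand₂ (M ∘ swap₀₁)) (det-expand₂ M))
    (expand₂-antisym p (M (suc zero)) (M zero) (λ g → det p (λ r c → M (suc (suc r)) (g c)))
      (λ g≗h → det-cong (λ r c → cong (M (suc (suc r))) (g≗h c))))

  i+i≡0⇒i≡0 : ∀ (i : ℤ) → i + i ≡ + 0 → i ≡ + 0
  i+i≡0⇒i≡0 i i+i≡0 = ℤ.*-cancelˡ-≡ (+ 2) i (+ 0) (trans (double i) i+i≡0)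
    where
    double : ∀ i → + 2 * i ≡ i + i
    double = solve-∀

  det-equalRows : ∀ {n} (M : Matrix n) {i j} → i ≢ j → M i ≗ M j → det n M ≡ + 0
  det-equalLaterRows : ∀ {n} (M : Matrix (suc n)) {i j : Fin n} → i ≢ j → M (suc i) ≗ M (suc j) → det (suc n) M ≡ + 0
  det-repeatedFirstRow : ∀ {n} (M : Matrix (suc n)) j → M zero ≗ M (suc j) → det (suc n) M ≡ + 0

  det-equalRows         M {zero}  {zero}  0≢0 _  = contradiction refl 0≢0
  det-equalRows {suc n} M {zero}  {suc j} _   eq = det-repeatedFirstRow {n} M j eq
  det-equalRows {suc n} M {suc i} {zero}  _   eq = det-repeatedFirstRow {n} M i (sym ∘ eq)
  det-equalRows {suc n} M {suc i} {suc j} i≢j eq = det-equalLaterRows {n} M (i≢j ∘ cong suc) eq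

  det-equalLaterRows {n} M i≢j eq = trans (det-expand M) (∑-zero _ (λ c →
    trans (cong (λ d → sign (toℕ c) * (M zero c * d)) (det-equalRows {n} (minor M c) i≢j (eq ∘ punchIn c)))
          (annihilate (sign (toℕ c)) (M zero c))))
    where
    annihilate : ∀ s x → s * (x * + 0) ≡ + 0
    annihilate = solve-∀

  det-repeatedFirstRow {suc p} M zero eq = i+i≡0⇒i≡0 (det (suc (suc p)) M)
    (trans (cong (_+ det (suc (suc p)) M) (sym (det-cong swapped≐M))) (det-swap₀₁ M))
    where
    swapped≐M : ∀ r c → (M ∘ swap₀₁) r c ≡ M r c
    swapped≐M zero          c = sym (eq c)
    swapped≐M (suc zero)    c = eq c
    swapped≐M (suc (suc r)) c = refl
  det-repeatedFirstRow {suc p} M (suc j) eq = begin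
    det (suc (suc p)) M                                      ≡⟨ ℤ.+-identityˡ _ ⟨
    + 0 + det (suc (suc p)) M
      ≡⟨ cong (_+ det (suc (suc p)) M) (det-equalLaterRows {suc p} (M ∘ swap₀₁) {zero} {suc j} (λ ()) eq) ⟨
    det (suc (suc p)) (M ∘ swap₀₁) + det (suc (suc p)) M    ≡⟨ det-swap₀₁ M ⟩
    + 0                                                      ∎


  minor-update : ∀ {n} (M : Matrix (suc n)) t v c →
    ∀ r c′ → minor (M [ suc t ]≔ v) c r c′ ≡ (minor M c [ t ]≔ (v ∘ punchIn c)) r c′
  minor-update M t v c r c′ = cong (λ row → row c′) (map-updateAt-local {f = _∘ punchIn c} (M ∘ suc) t refl r)

  ∑-∑-*ˡ : ∀ {k l} (μ : Fin k → ℤ) (x : Fin k → Fin l → ℤ) →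
    ∑[ c < l ] ∑[ i < k ] (μ i * x i c) ≡ ∑[ i < k ] (μ i * ∑[ c < l ] x i c)
  ∑-∑-*ˡ μ x = trans (sym (∑-comm (λ i c → μ i * x i c))) (sum-cong-≗ (λ i → sym (*-distribˡ-sum (μ i) (x i))))

  det-linearRow : ∀ {n} (M : Matrix n) t {m} (μ : Fin m → ℤ) (R : Fin m → Fin n → ℤ) →
    det n (M [ t ]≔ (λ c → ∑[ i < m ] (μ i * R i c))) ≡ ∑[ i < m ] (μ i * det n (M [ t ]≔ R i))
  det-linearRow {suc n} M zero {m} μ R = begin
    det (suc n) (M [ zero ]≔ (λ c → ∑[ i < m ] (μ i * R i c)))
      ≡⟨ det-expand (M [ zero ]≔ (λ c → ∑[ i < m ] (μ i * R i c))) ⟩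
    ∑[ c < suc n ] (sign (toℕ c) * (∑[ i < m ] (μ i * R i c) * det n (minor M c)))
      ≡⟨ sum-cong-≗ (λ c → pull (sign (toℕ c)) (det n (minor M c)) (λ i → R i c)) ⟩
    ∑[ c < suc n ] ∑[ i < m ] (μ i * (sign (toℕ c) * (R i c * det n (minor M c))))
      ≡⟨ ∑-∑-*ˡ μ (λ i c → sign (toℕ c) * (R i c * det n (minor M c))) ⟩
    ∑[ i < m ] (μ i * ∑[ c < suc n ] (sign (toℕ c) * (R i c * det n (minor M c))))
      ≡⟨ sum-cong-≗ (λ i → cong (μ i *_) (sym (det-expand (M [ zero ]≔ R i)))) ⟩
    ∑[ i < m ] (μ i * det (suc n) (M [ zero ]≔ R i)) ∎
    where
    pull : ∀ s d (y : Fin m → ℤ) → s * (∑[ i < m ] (μ i * y i) * d) ≡ ∑[ i < m ] (μ i * (s * (y i * d)))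
    pull s d y = trans (cong (s *_) (*-distribʳ-sum d (λ i → μ i * y i)))
      (trans (*-distribˡ-sum s (λ i → μ i * y i * d)) (sum-cong-≗ (λ i → shuffle s (μ i) (y i) d)))
      where
      shuffle : ∀ s x y d → s * (x * y * d) ≡ x * (s * (y * d))
      shuffle = solve-∀
  det-linearRow {suc n} M (suc t) {m} μ R = begin
    det (suc n) (M [ suc t ]≔ v)
      ≡⟨ det-expand (M [ suc t ]≔ v) ⟩
    ∑[ c < suc n ] (sign (toℕ c) * (M zero c * det n (minor (M [ suc t ]≔ v) c)))
      ≡⟨ sum-cong-≗ (λ c → cong (λ d → sign (toℕ c) * (M zero c * d))
           (trans (det-cong (minor-update M t v c)) (det-linearRow (minor M c) t μ (λ i → R i ∘ punchIn c)))) ⟩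
    ∑[ c < suc n ] (sign (toℕ c) * (M zero c * ∑[ i < m ] (μ i * D i c)))
      ≡⟨ sum-cong-≗ (λ c → pull (sign (toℕ c)) (M zero c) (λ i → D i c)) ⟩
    ∑[ c < suc n ] ∑[ i < m ] (μ i * (sign (toℕ c) * (M zero c * D i c)))
      ≡⟨ ∑-∑-*ˡ μ (λ i c → sign (toℕ c) * (M zero c * D i c)) ⟩
    ∑[ i < m ] (μ i * ∑[ c < suc n ] (sign (toℕ c) * (M zero c * D i c)))
      ≡⟨ sum-cong-≗ (λ i → cong (μ i *_) (trans (sum-cong-≗ (λ c → cong (λ d → sign (toℕ c) * (M zero c * d))
           (sym (det-cong (minor-update M t (R i) c))))) (sym (det-expand (M [ suc t ]≔ R i))))) ⟩
    ∑[ i < m ] (μ i * det (suc n) (M [ suc t ]≔ R i)) ∎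
    where
    v : Fin (suc n) → ℤ
    v c = ∑[ i < m ] (μ i * R i c)
    D : Fin m → Fin (suc n) → ℤ
    D i c = det n (minor M c [ t ]≔ (R i ∘ punchIn c))
    pull : ∀ s a (y : Fin m → ℤ) → s * (a * ∑[ i < m ] (μ i * y i)) ≡ ∑[ i < m ] (μ i * (s * (a * y i)))
    pull s a y = trans (cong (s *_) (*-distribˡ-sum a (λ i → μ i * y i)))
      (trans (*-distribˡ-sum s (λ i → a * (μ i * y i))) (sum-cong-≗ (λ i → shuffle s a (μ i) (y i))))
      where
      shuffle : ∀ s a x y → s * (a * (x * y)) ≡ x * (s * (a * y))
      shuffle = solve-∀

  det-replaceRow : ∀ {n} (M : Matrix n) t (μ : Fin n → ℤ) →
    det n (M [ t ]≔ (λ c → ∑[ i < n ] (μ i * M i c))) ≡ μ t * det n M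
  det-replaceRow {n} M t μ = begin
    det n (M [ t ]≔ (λ c → ∑[ i < n ] (μ i * M i c)))
      ≡⟨ det-linearRow M t μ M ⟩
    ∑[ i < n ] (μ i * det n (M [ t ]≔ M i))
      ≡⟨ ∑-single t (λ i → μ i * det n (M [ t ]≔ M i)) (λ i i≢t →
           trans (cong (μ i *_) (det-equalRows (M [ t ]≔ M i) i≢t (repeated i i≢t))) (ℤ.*-zeroʳ (μ i))) ⟩
    μ t * det n (M [ t ]≔ M t)
      ≡⟨ cong (μ t *_) (det-cong (λ r → cong-app (updateAt-id-local t M refl r))) ⟩
    μ t * det n M ∎
    where
    repeated : ∀ i → i ≢ t → (M [ t ]≔ M i) i ≗ (M [ t ]≔ M i) t
    repeated i i≢t c = cong (λ row → row c) (trans (updateAt-minimal i t M i≢t) (sym (updateAt-updates t M)))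

  module _ {n} (rank : Fin n → Fin n) (rank-injective : Injective _≡_ _≡_ rank) (L M : Matrix n)
           (L-diag : ∀ j → L j j ≡ + 1) (L-triangular : ∀ j i → rank i Fin.< rank j → L j i ≡ + 0) where

    private
      LM : Matrix n
      LM j c = ∑[ i < n ] (L j i * M i c)

      record Stage (t : ℕ) (X : Matrix n) : Set where
        field
          transformed : ∀ j → toℕ (rank j) ℕ.< t → X j ≗ LM j
          original    : ∀ j → t ℕ.≤ toℕ (rank j) → X j ≗ M j

      -- Row j₀ of L M combines only rows of rank ≥ t, which are still rows of M,
      -- so reverting it to M j₀ is a row operation.
      module Revert {t X} (stage : Stage (suc t) X) (j₀ : Fin n) (rank≡t : toℕ (rank j₀) ≡ t) where
        open Stage stage

        X′ : Matrix n
        X′ = X [ j₀ ]≔ M j₀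

        stage′ : Stage t X′
        stage′ = record { transformed = transformed′ ; original = original′ }
          where
          transformed′ : ∀ j → toℕ (rank j) ℕ.< t → X′ j ≗ LM j
          transformed′ j r<t c =
            trans (cong (λ row → row c) (updateAt-minimal j j₀ X j≢j₀)) (transformed j (ℕ.m≤n⇒m≤1+n r<t) c)
            where
            j≢j₀ : j ≢ j₀
            j≢j₀ refl = ℕ.<-irrefl rank≡t r<t
          original′ : ∀ j → t ℕ.≤ toℕ (rank j) → X′ j ≗ M j
          original′ j t≤r c with j Fin.≟ j₀
          ... | yes refl = cong (λ row → row c) (updateAt-updates j₀ X)
          ... | no j≢j₀  =
            trans (cong (λ row → row c) (updateAt-minimal j j₀ X j≢j₀)) (original j (ℕ.≤∧≢⇒< t≤r t≢r) c)
            where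
            t≢r : t ≢ toℕ (rank j)
            t≢r t≡r = j≢j₀ (rank-injective (toℕ-injective (trans (sym t≡r) (sym rank≡t))))

        combination : ∀ c → LM j₀ c ≡ ∑[ i < n ] (L j₀ i * X′ i c)
        combination c = sum-cong-≗ term
          where
          term : ∀ i → L j₀ i * M i c ≡ L j₀ i * X′ i c
          term i with toℕ (rank i) ℕ.<? t
          ... | yes r<t = trans (cong (_* M i c) L≡0) (trans (ℤ.*-zeroˡ (M i c))
                            (sym (trans (cong (_* X′ i c) L≡0) (ℤ.*-zeroˡ (X′ i c)))))
            where
            L≡0 : L j₀ i ≡ + 0
            L≡0 = L-triangular j₀ i (subst (toℕ (rank i) ℕ.<_) (sym rank≡t) r<t)
          ... | no r≮t  = cong (L j₀ i *_) (sym (Stage.original stage′ i (ℕ.≮⇒≥ r≮t) c))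

        det-revert : det n X ≡ det n X′
        det-revert = begin
          det n X                                                  ≡⟨ det-cong X≐ ⟩
          det n (X′ [ j₀ ]≔ (λ c → ∑[ i < n ] (L j₀ i * X′ i c)))  ≡⟨ det-replaceRow X′ j₀ (L j₀) ⟩
          L j₀ j₀ * det n X′                                       ≡⟨ cong (_* det n X′) (L-diag j₀) ⟩
          + 1 * det n X′                                           ≡⟨ ℤ.*-identityˡ (det n X′) ⟩
          det n X′                                                 ∎
          where
          X≐ : ∀ j c → X j c ≡ (X′ [ j₀ ]≔ (λ c → ∑[ i < n ] (L j₀ i * X′ i c))) j c
          X≐ j c with j Fin.≟ j₀
          ... | yes refl = trans (transformed j₀ (ℕ.≤-reflexive (cong suc rank≡t)) c)
                             (trans (combination c) (sym (cong (λ row → row c) (updateAt-updates j₀ X′))))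
          ... | no j≢j₀  = sym (trans (cong (λ row → row c) (updateAt-minimal j j₀ X′ j≢j₀))
                                    (cong (λ row → row c) (updateAt-minimal j j₀ X j≢j₀)))

      revert : ∀ t X → Stage t X → det n X ≡ det n M
      revert zero    X stage = det-cong (λ j → Stage.original stage j z≤n)
      revert (suc t) X stage with any? (λ j → toℕ (rank j) ℕ.≟ t)
      ... | no ∄              = revert t X (record
        { transformed = λ j r<t → Stage.transformed stage j (ℕ.m≤n⇒m≤1+n r<t)
        ; original    = λ j t≤r → Stage.original stage j (ℕ.≤∧≢⇒< t≤r (λ t≡r → ∄ (j , sym t≡r)))
        })
      ... | yes (j₀ , rank≡t) = trans det-revert (revert t X′ stage′)
        where open Revert stage j₀ rank≡t

    det-unitriangular : det n (λ j c → ∑[ i < n ] (L j i * M i c)) ≡ det n M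
    det-unitriangular = revert n LM (record
      { transformed = λ _ _ _ → refl
      ; original    = λ j n≤r → contradiction (toℕ<n (rank j)) (ℕ.≤⇒≯ n≤r)
      })

  ⟦_⟧ : ∀ {n} → (ℕ → ℕ → ℕ) → Matrix n
  ⟦ m ⟧ i j = + m (toℕ i) (toℕ j)

  pos-∑ℕ : ∀ n (f : ℕ → ℕ) → + ∑ℕ n f ≡ ∑[ i < n ] (+ f (toℕ i))
  pos-∑ℕ zero    f = refl
  pos-∑ℕ (suc n) f = trans (ℤ.pos-+ (f 0) (∑ℕ n (f ∘ suc))) (cong (λ z → + f 0 + z) (pos-∑ℕ n (f ∘ suc)))

  det-unitriangularℕ : ∀ {n} (rank : Fin n → Fin n) → Injective _≡_ _≡_ rank → (ℓ m m′ : ℕ → ℕ → ℕ) →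
    (∀ j → ℓ j j ≡ 1) → (∀ (j i : Fin n) → rank i Fin.< rank j → ℓ (toℕ j) (toℕ i) ≡ 0) →
    (∀ j c → j ℕ.< n → c ℕ.< n → m′ j c ≡ ∑ℕ[ i < n ] (ℓ j i ℕ.* m i c)) →
    det n ⟦ m′ ⟧ ≡ det n ⟦ m ⟧
  det-unitriangularℕ {n} rank rank-injective ℓ m m′ ℓ-diag ℓ-triangular m′≡ℓm = begin
    det n ⟦ m′ ⟧
      ≡⟨ det-cong entries ⟩
    det n (λ j c → ∑[ i < n ] (⟦ ℓ ⟧ j i * ⟦ m ⟧ i c))
      ≡⟨ det-unitriangular rank rank-injective ⟦ ℓ ⟧ ⟦ m ⟧ (λ j → cong +_ (ℓ-diag (toℕ j)))
           (λ j i i<j → cong +_ (ℓ-triangular j i i<j)) ⟩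
    det n ⟦ m ⟧ ∎
    where
    entries : ∀ j c → ⟦ m′ ⟧ j c ≡ ∑[ i < n ] (⟦ ℓ ⟧ j i * ⟦ m ⟧ i c)
    entries j c = begin
      + m′ (toℕ j) (toℕ c)
        ≡⟨ cong +_ (m′≡ℓm (toℕ j) (toℕ c) (toℕ<n j) (toℕ<n c)) ⟩
      + ∑ℕ[ i < n ] (ℓ (toℕ j) i ℕ.* m i (toℕ c))
        ≡⟨ pos-∑ℕ n (λ i → ℓ (toℕ j) i ℕ.* m i (toℕ c)) ⟩
      ∑[ i < n ] (+ (ℓ (toℕ j) (toℕ i) ℕ.* m (toℕ i) (toℕ c)))
        ≡⟨ sum-cong-≗ {n} (λ i → ℤ.pos-* (ℓ (toℕ j) (toℕ i)) (m (toℕ i) (toℕ c))) ⟩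
      ∑[ i < n ] (⟦ ℓ ⟧ j i * ⟦ m ⟧ i c) ∎

  det-lowerUnitriangular : ∀ {n} (ℓ m m′ : ℕ → ℕ → ℕ) →
    (∀ j → ℓ j j ≡ 1) → (∀ j i → j ℕ.< i → i ℕ.< n → ℓ j i ≡ 0) →
    (∀ j c → j ℕ.< n → c ℕ.< n → m′ j c ≡ ∑ℕ[ i < n ] (ℓ j i ℕ.* m i c)) →
    det n ⟦ m′ ⟧ ≡ det n ⟦ m ⟧
  det-lowerUnitriangular {n} ℓ m m′ ℓ-diag ℓ-lower =
    det-unitriangularℕ opposite opposite-injective ℓ m m′ ℓ-diag
      (λ j i i<j → ℓ-lower (toℕ j) (toℕ i) (reverse j i i<j) (toℕ<n i))
    where
    opposite-injective : Injective _≡_ _≡_ (opposite {n})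
    opposite-injective {x} {y} eq = trans (sym (opposite-involutive x)) (trans (cong opposite eq) (opposite-involutive y))
    reverse : ∀ (j i : Fin n) → opposite i Fin.< opposite j → toℕ j ℕ.< toℕ i
    reverse j i i<j = ℕ.≰⇒> (λ i≤j → ℕ.<⇒≱ (subst₂ ℕ._<_ (opposite-prop i) (opposite-prop j) i<j)
      (ℕ.∸-monoʳ-≤ n (s≤s i≤j)))

  det-upperUnitriangular : ∀ {n} (ℓ m m′ : ℕ → ℕ → ℕ) →
    (∀ j → ℓ j j ≡ 1) → (∀ j i → i ℕ.< j → j ℕ.< n → ℓ j i ≡ 0) →
    (∀ j c → j ℕ.< n → c ℕ.< n → m′ j c ≡ ∑ℕ[ i < n ] (ℓ j i ℕ.* m i c)) →
    det n ⟦ m′ ⟧ ≡ det n ⟦ m ⟧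
  det-upperUnitriangular ℓ m m′ ℓ-diag ℓ-upper =
    det-unitriangularℕ (λ i → i) (λ eq → eq) ℓ m m′ ℓ-diag (λ j i i<j → ℓ-upper (toℕ j) (toℕ i) i<j (toℕ<n j))

-- Binomial coefficients and lattice points

module _ where

  open import Data.Nat using (_+_; _*_; _∸_; _^_; _≤_; _<_; _≟_; _<?_; NonZero)
  open import Data.Nat.Properties
  open import Data.Nat.Combinatorics using (_C_; nCk+nC[k+1]≡[n+1]C[k+1]; nCn≡1; nC1≡n; k>n⇒nCk≡0)
  open import Data.Nat.DivMod using (_/_; m<n*o⇒m/o<n; /-monoˡ-≤; m*n/n≡m)
  open import Data.Nat.ListAction using (sum)
  open import Data.Nat.ListAction.Properties using (sum-++)
  open import Data.List using (List; []; _∷_; _++_; map; concatMap; filter; length; upTo)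
  open import Data.List.Properties using (map-++; map-∘; map-cong; map-upTo; filter-accept; filter-reject)
  open import Data.Vec as Vec using (Vec; _∷_)
  open import Data.Nat.Tactic.RingSolver using (solve-∀)

  C-pascal : ∀ n k → suc n C suc k ≡ n C k + n C suc k
  C-pascal n k = sym (nCk+nC[k+1]≡[n+1]C[k+1] n k)

  C-absorb : ∀ n k → suc k * (suc n C suc k) ≡ suc n * (n C k)
  C-absorb zero    zero    = refl
  C-absorb zero    (suc k) = *-zeroʳ (suc (suc k))
  C-absorb (suc n) zero    = trans (*-identityˡ (suc (suc n) C 1)) (trans (nC1≡n (suc (suc n))) (sym (*-identityʳ (suc (suc n)))))
  C-absorb (suc n) (suc k) = begin
    suc (suc k) * (suc (suc n) C suc (suc k))
      ≡⟨ cong (suc (suc k) *_) (C-pascal (suc n) (suc k)) ⟩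
    suc (suc k) * (suc n C suc k + suc n C suc (suc k))
      ≡⟨ split k (suc n C suc k) (suc n C suc (suc k)) ⟩
    suc n C suc k + suc k * (suc n C suc k) + suc (suc k) * (suc n C suc (suc k))
      ≡⟨ cong₂ (λ x y → suc n C suc k + x + y) (C-absorb n k) (C-absorb n (suc k)) ⟩
    suc n C suc k + suc n * (n C k) + suc n * (n C suc k)
      ≡⟨ merge n (suc n C suc k) (n C k) (n C suc k) ⟩
    suc n C suc k + suc n * (n C k + n C suc k)
      ≡⟨ cong (λ x → suc n C suc k + suc n * x) (C-pascal n k) ⟨
    suc (suc n) * (suc n C suc k) ∎
    where
    split : ∀ k x y → suc (suc k) * (x + y) ≡ x + suc k * x + suc (suc k) * y
    split = solve-∀
    merge : ∀ n x y z → x + suc n * y + suc n * z ≡ x + suc n * (y + z)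
    merge = solve-∀

  C-vandermonde : ∀ y s m → (y + s) C m ≡ ∑ℕ[ i < suc m ] ((s C (m ∸ i)) * (y C i))
  C-vandermonde zero    s m = sym (begin
    (s C m) * 1 + ∑ℕ[ i < m ] ((s C (m ∸ suc i)) * 0)
      ≡⟨ cong₂ _+_ (*-identityʳ (s C m)) (trans (∑ℕ-cong m (λ i → *-zeroʳ (s C (m ∸ suc i)))) (∑ℕ-zero m)) ⟩
    s C m + 0
      ≡⟨ +-identityʳ (s C m) ⟩
    s C m ∎)
  C-vandermonde (suc y) s zero    = refl
  C-vandermonde (suc y) s (suc m) = begin
    suc (y + s) C suc m
      ≡⟨ C-pascal (y + s) m ⟩
    (y + s) C m + (y + s) C suc m
      ≡⟨ cong₂ _+_ (C-vandermonde y s m) (C-vandermonde y s (suc m)) ⟩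
    P + ((s C suc m) * 1 + Q)
      ≡⟨ shuffle P ((s C suc m) * 1) Q ⟩
    (s C suc m) * 1 + (P + Q)
      ≡⟨ cong ((s C suc m) * 1 +_)
           (∑ℕ-distrib-+ (suc m) (λ i → (s C (m ∸ i)) * (y C i)) (λ i → (s C (m ∸ i)) * (y C suc i))) ⟨
    (s C suc m) * 1 + ∑ℕ[ i < suc m ] ((s C (m ∸ i)) * (y C i) + (s C (m ∸ i)) * (y C suc i))
      ≡⟨ cong ((s C suc m) * 1 +_) (∑ℕ-cong (suc m) (λ i →
           trans (sym (*-distribˡ-+ (s C (m ∸ i)) (y C i) (y C suc i))) (cong ((s C (m ∸ i)) *_) (sym (C-pascal y i))))) ⟩
    (s C suc m) * 1 + ∑ℕ[ i < suc m ] ((s C (m ∸ i)) * (suc y C suc i)) ∎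
    where
    P Q : ℕ
    P = ∑ℕ[ i < suc m ] ((s C (m ∸ i)) * (y C i))
    Q = ∑ℕ[ i < suc m ] ((s C (m ∸ i)) * (y C suc i))
    shuffle : ∀ p x q → p + (x + q) ≡ x + (p + q)
    shuffle = solve-∀

  ^-choose2 : ∀ N n → N ^ n * N ^ (n C 2) ≡ N ^ (suc n C 2)
  ^-choose2 N n = begin
    N ^ n * N ^ (n C 2)  ≡⟨ ^-distribˡ-+-* N n (n C 2) ⟨
    N ^ (n + n C 2)      ≡⟨ cong (λ e → N ^ (e + n C 2)) (nC1≡n n) ⟨
    N ^ (n C 1 + n C 2)  ≡⟨ cong (N ^_) (C-pascal n 1) ⟨
    N ^ (suc n C 2)      ∎

  -- simplex k M = #{x ∈ ℕᵏ : x₁ + ⋯ + x_k < M} (stars and bars).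
  simplex : ℕ → ℕ → ℕ
  simplex k zero    = 0
  simplex k (suc m) = (m + k) C k

  simplex-suc : ∀ k M → simplex (suc k) M ≡ ∑ℕ[ v < M ] simplex k (M ∸ v)
  simplex-suc k zero          = refl
  simplex-suc k (suc zero)    = trans (nCn≡1 (suc k)) (sym (trans (+-identityʳ (k C k)) (nCn≡1 k)))
  simplex-suc k (suc (suc m)) = begin
    suc (m + suc k) C suc k
      ≡⟨ C-pascal (m + suc k) k ⟩
    (m + suc k) C k + (m + suc k) C suc k
      ≡⟨ cong (λ x → x C k + (m + suc k) C suc k) (+-suc m k) ⟩
    simplex k (suc (suc m)) + simplex (suc k) (suc m)
      ≡⟨ cong (simplex k (suc (suc m)) +_) (simplex-suc k (suc m)) ⟩
    simplex k (suc (suc m)) + ∑ℕ[ v < suc m ] simplex k (suc m ∸ v) ∎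

  simplex₀-positive : ∀ {M} → 0 < M → simplex 0 M ≡ 1
  simplex₀-positive {suc m} _ = refl

  simplex-extend : ∀ k M L → M ≤ L → ∑ℕ[ v < L ] simplex k (M ∸ v) ≡ simplex (suc k) M
  simplex-extend k M L M≤L = begin
    ∑ℕ[ v < L ] simplex k (M ∸ v)
      ≡⟨ cong (λ L → ∑ℕ[ v < L ] simplex k (M ∸ v)) (m+[n∸m]≡n M≤L) ⟨
    ∑ℕ[ v < M + (L ∸ M) ] simplex k (M ∸ v)
      ≡⟨ ∑ℕ-split M (L ∸ M) (λ v → simplex k (M ∸ v)) ⟩
    ∑ℕ[ v < M ] simplex k (M ∸ v) + ∑ℕ[ v < L ∸ M ] simplex k (M ∸ (M + v))
      ≡⟨ cong₂ _+_ (sym (simplex-suc k M))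
           (trans (∑ℕ-cong (L ∸ M) (λ v → cong (simplex k) (m≤n⇒m∸n≡0 (m≤m+n M v)))) (∑ℕ-zero (L ∸ M))) ⟩
    simplex (suc k) M + 0
      ≡⟨ +-identityʳ _ ⟩
    simplex (suc k) M ∎

  simplex-closedForm : ∀ n x c → c < n → simplex (suc n) (x ∸ c) ≡ (suc x + (n ∸ suc c)) C suc n
  simplex-closedForm n x c c<n with c <? x
  ... | yes c<x = begin
    simplex (suc n) (x ∸ c)                  ≡⟨ cong (simplex (suc n)) (+-∸-assoc 1 c<x) ⟩
    (x ∸ suc c + suc n) C suc n              ≡⟨ cong (_C suc n) arithmetic ⟩
    (suc x + (n ∸ suc c)) C suc n            ∎
    where
    rearrange : ∀ b a c → b + suc (suc c + a) ≡ suc (suc c + b) + a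
    rearrange = solve-∀
    arithmetic : x ∸ suc c + suc n ≡ suc x + (n ∸ suc c)
    arithmetic = begin
      x ∸ suc c + suc n                            ≡⟨ cong (λ m → x ∸ suc c + suc m) (m+[n∸m]≡n c<n) ⟨
      x ∸ suc c + suc (suc c + (n ∸ suc c))        ≡⟨ rearrange (x ∸ suc c) (n ∸ suc c) c ⟩
      suc (suc c + (x ∸ suc c)) + (n ∸ suc c)      ≡⟨ cong (λ m → suc m + (n ∸ suc c)) (m+[n∸m]≡n c<x) ⟩
      suc x + (n ∸ suc c)                          ∎
  ... | no c≮x  = begin
    simplex (suc n) (x ∸ c)                  ≡⟨ cong (simplex (suc n)) (m≤n⇒m∸n≡0 (≮⇒≥ c≮x)) ⟩
    0
      ≡⟨ k>n⇒nCk≡0 (s≤s (≤-trans (+-monoˡ-≤ (n ∸ suc c) (s≤s (≮⇒≥ c≮x))) (≤-reflexive (m+[n∸m]≡n c<n)))) ⟨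
    (suc x + (n ∸ suc c)) C suc n            ∎

  δ : ℕ → ℕ → ℕ
  δ zero    zero    = 1
  δ zero    (suc j) = 0
  δ (suc i) zero    = 0
  δ (suc i) (suc j) = δ i j

  δ-diag : ∀ i → δ i i ≡ 1
  δ-diag zero    = refl
  δ-diag (suc i) = δ-diag i

  δ-off : ∀ {i j} → i ≢ j → δ i j ≡ 0
  δ-off {zero}  {zero}  0≢0 = contradiction refl 0≢0
  δ-off {zero}  {suc j} _   = refl
  δ-off {suc i} {zero}  _   = refl
  δ-off {suc i} {suc j} i≢j = δ-off (i≢j ∘ cong suc)

  ∑ℕ-δ : ∀ n q (f : ℕ → ℕ) → (n ≤ q → f q ≡ 0) → ∑ℕ[ i < n ] (δ q i * f i) ≡ f q
  ∑ℕ-δ zero    q       f vanish = sym (vanish z≤n)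
  ∑ℕ-δ (suc n) zero    f vanish = trans (cong₂ _+_ (*-identityˡ (f 0)) (∑ℕ-zero n)) (+-identityʳ (f 0))
  ∑ℕ-δ (suc n) (suc q) f vanish = ∑ℕ-δ n q (f ∘ suc) (vanish ∘ s≤s)

  length-filter-∷ : ∀ {A : Set} (q : A → ℕ) i x xs →
    length (filter (λ y → q y ≟ i) (x ∷ xs)) ≡ δ (q x) i + length (filter (λ y → q y ≟ i) xs)
  length-filter-∷ q i x xs with q x ≟ i
  ... | yes qx≡i = trans (cong length (filter-accept (λ y → q y ≟ i) qx≡i))
                         (cong (_+ length (filter (λ y → q y ≟ i) xs)) (sym (trans (cong (λ j → δ j i) qx≡i) (δ-diag i))))
  ... | no qx≢i  = trans (cong length (filter-reject (λ y → q y ≟ i) qx≢i))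
                         (cong (_+ length (filter (λ y → q y ≟ i) xs)) (sym (δ-off qx≢i)))

  ∑ℕ-fibres : ∀ {A : Set} n (q : A → ℕ) (w : ℕ → ℕ) (xs : List A) → (∀ i → n ≤ i → w i ≡ 0) →
    ∑ℕ[ i < n ] (w i * length (filter (λ x → q x ≟ i) xs)) ≡ sum (map (w ∘ q) xs)
  ∑ℕ-fibres n q w []       vanish = trans (∑ℕ-cong n (λ i → *-zeroʳ (w i))) (∑ℕ-zero n)
  ∑ℕ-fibres n q w (x ∷ xs) vanish = begin
    ∑ℕ[ i < n ] (w i * length (filter (λ y → q y ≟ i) (x ∷ xs)))
      ≡⟨ ∑ℕ-cong n (λ i → trans (cong (w i *_) (length-filter-∷ q i x xs)) (distrib (w i) (δ (q x) i) _)) ⟩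
    ∑ℕ[ i < n ] (δ (q x) i * w i + w i * length (filter (λ y → q y ≟ i) xs))
      ≡⟨ ∑ℕ-distrib-+ n (λ i → δ (q x) i * w i) (λ i → w i * length (filter (λ y → q y ≟ i) xs)) ⟩
    ∑ℕ[ i < n ] (δ (q x) i * w i) + ∑ℕ[ i < n ] (w i * length (filter (λ y → q y ≟ i) xs))
      ≡⟨ cong₂ _+_ (∑ℕ-δ n (q x) w (vanish (q x))) (∑ℕ-fibres n q w xs vanish) ⟩
    w (q x) + sum (map (w ∘ q) xs) ∎
    where
    distrib : ∀ w d c → w * (d + c) ≡ d * w + w * c
    distrib = solve-∀

  sum-map-concatMap : ∀ {A B : Set} (f : B → ℕ) (g : A → List B) xs →
    sum (map f (concatMap g xs)) ≡ sum (map (λ x → sum (map f (g x))) xs)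
  sum-map-concatMap f g []       = refl
  sum-map-concatMap f g (x ∷ xs) = begin
    sum (map f (g x ++ concatMap g xs))
      ≡⟨ cong sum (map-++ f (g x) (concatMap g xs)) ⟩
    sum (map f (g x) ++ map f (concatMap g xs))
      ≡⟨ sum-++ (map f (g x)) (map f (concatMap g xs)) ⟩
    sum (map f (g x)) + sum (map f (concatMap g xs))
      ≡⟨ cong (sum (map f (g x)) +_) (sum-map-concatMap f g xs) ⟩
    sum (map f (g x)) + sum (map (λ x → sum (map f (g x))) xs) ∎

  sum-tuples-suc : ∀ k N (f : Vec ℕ (suc k) → ℕ) →
    sum (map f (tuples (suc k) N)) ≡ ∑ℕ[ d < N ] sum (map (f ∘ (d ∷_)) (tuples k N))
  sum-tuples-suc k N f = begin
    sum (map f (concatMap (λ d → map (d ∷_) (tuples k N)) (upTo N)))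
      ≡⟨ sum-map-concatMap f (λ d → map (d ∷_) (tuples k N)) (upTo N) ⟩
    sum (map (λ d → sum (map f (map (d ∷_) (tuples k N)))) (upTo N))
      ≡⟨ cong sum (map-upTo (λ d → sum (map f (map (d ∷_) (tuples k N)))) N) ⟩
    ∑ℕ[ d < N ] sum (map f (map (d ∷_) (tuples k N)))
      ≡⟨ ∑ℕ-cong N (λ d → cong sum (sym (map-∘ (tuples k N)))) ⟩
    ∑ℕ[ d < N ] sum (map (f ∘ (d ∷_)) (tuples k N)) ∎

  sum-map-∑ℕ : ∀ {A : Set} n (g : A → ℕ → ℕ) (xs : List A) →
    sum (map (λ x → ∑ℕ[ i < n ] g x i) xs) ≡ ∑ℕ[ i < n ] sum (map (λ x → g x i) xs)
  sum-map-∑ℕ n g []       = sym (∑ℕ-zero n)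
  sum-map-∑ℕ n g (x ∷ xs) = trans (cong (∑ℕ n (g x) +_) (sum-map-∑ℕ n g xs))
    (sym (∑ℕ-distrib-+ n (g x) (λ i → sum (map (λ x → g x i) xs))))

  module _ (N : ℕ) .{{_ : NonZero N}} where

    quotient : ∀ {k} → ℕ → Vec ℕ k → ℕ
    quotient c t = (Vec.sum t + c) / N

    -- Both sides count the x ∈ ℕᵏ with x₁ + ⋯ + x_k + c < A N; on the left they are grouped by
    -- their residues t = x mod N, and then x = t + N y with y₁ + ⋯ + y_k < A - quotient c t.
    simplex-tuples : ∀ k A c → sum (map (λ t → simplex k (A ∸ quotient c t)) (tuples k N)) ≡ simplex k (A * N ∸ c)
    simplex-tuples zero    A c with c <? A * N
    ... | yes c<AN = trans (+-identityʳ _) (trans (simplex₀-positive (m<n⇒0<n∸m (m<n*o⇒m/o<n c<AN)))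
                                                 (sym (simplex₀-positive (m<n⇒0<n∸m c<AN))))
    ... | no c≮AN  = trans (+-identityʳ _) (trans (cong (simplex 0) (m≤n⇒m∸n≡0 A≤c/N))
                                                 (sym (cong (simplex 0) (m≤n⇒m∸n≡0 (≮⇒≥ c≮AN)))))
      where
      A≤c/N : A ≤ c / N
      A≤c/N = subst (_≤ c / N) (m*n/n≡m A N) (/-monoˡ-≤ N (≮⇒≥ c≮AN))
    simplex-tuples (suc k) A c = begin
      sum (map (λ t → simplex (suc k) (A ∸ quotient c t)) (tuples (suc k) N))
        ≡⟨ sum-tuples-suc k N (λ t → simplex (suc k) (A ∸ quotient c t)) ⟩
      ∑ℕ[ d < N ] sum (map (λ t → simplex (suc k) (A ∸ quotient c (d ∷ t))) (tuples k N))
        ≡⟨ ∑ℕ-cong N (λ d → cong sum (map-cong (peel d) (tuples k N))) ⟩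
      ∑ℕ[ d < N ] sum (map (λ t → ∑ℕ[ a < A ] simplex k ((A ∸ a) ∸ quotient (c + d) t)) (tuples k N))
        ≡⟨ ∑ℕ-cong N (λ d → sum-map-∑ℕ A (λ t a → simplex k ((A ∸ a) ∸ quotient (c + d) t)) (tuples k N)) ⟩
      ∑ℕ[ d < N ] ∑ℕ[ a < A ] sum (map (λ t → simplex k ((A ∸ a) ∸ quotient (c + d) t)) (tuples k N))
        ≡⟨ ∑ℕ-cong N (λ d → ∑ℕ-cong A (λ a → simplex-tuples k (A ∸ a) (c + d))) ⟩
      ∑ℕ[ d < N ] ∑ℕ[ a < A ] simplex k ((A ∸ a) * N ∸ (c + d))
        ≡⟨ ∑ℕ-comm N A (λ d a → simplex k ((A ∸ a) * N ∸ (c + d))) ⟩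
      ∑ℕ[ a < A ] ∑ℕ[ d < N ] simplex k ((A ∸ a) * N ∸ (c + d))
        ≡⟨ ∑ℕ-cong A (λ a → ∑ℕ-cong N (λ d → cong (simplex k) (shift a d))) ⟩
      ∑ℕ[ a < A ] ∑ℕ[ d < N ] simplex k ((A * N ∸ c) ∸ (a * N + d))
        ≡⟨ ∑ℕ-blocks A N (λ v → simplex k ((A * N ∸ c) ∸ v)) ⟨
      ∑ℕ[ v < A * N ] simplex k ((A * N ∸ c) ∸ v)
        ≡⟨ simplex-extend k (A * N ∸ c) (A * N) (m∸n≤m (A * N) c) ⟩
      simplex (suc k) (A * N ∸ c) ∎
      where
      peel : ∀ d t → simplex (suc k) (A ∸ quotient c (d ∷ t)) ≡ ∑ℕ[ a < A ] simplex k ((A ∸ a) ∸ quotient (c + d) t)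
      peel d t = begin
        simplex (suc k) (A ∸ quotient c (d ∷ t))
          ≡⟨ cong (λ x → simplex (suc k) (A ∸ x / N)) (reorder d (Vec.sum t) c) ⟩
        simplex (suc k) (A ∸ quotient (c + d) t)
          ≡⟨ simplex-extend k (A ∸ quotient (c + d) t) A (m∸n≤m A (quotient (c + d) t)) ⟨
        ∑ℕ[ a < A ] simplex k ((A ∸ quotient (c + d) t) ∸ a)
          ≡⟨ ∑ℕ-cong A (λ a → cong (simplex k) (∸-exchange A (quotient (c + d) t) a)) ⟩
        ∑ℕ[ a < A ] simplex k ((A ∸ a) ∸ quotient (c + d) t) ∎
        where
        reorder : ∀ d s c → d + s + c ≡ s + (c + d)
        reorder = solve-∀
        ∸-exchange : ∀ m n o → m ∸ n ∸ o ≡ m ∸ o ∸ n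
        ∸-exchange m n o = trans (∸-+-assoc m n o) (trans (cong (m ∸_) (+-comm n o)) (sym (∸-+-assoc m o n)))
      shift : ∀ a d → (A ∸ a) * N ∸ (c + d) ≡ (A * N ∸ c) ∸ (a * N + d)
      shift a d = begin
        (A ∸ a) * N ∸ (c + d)       ≡⟨ cong (_∸ (c + d)) (*-distribʳ-∸ N A a) ⟩
        (A * N ∸ a * N) ∸ (c + d)   ≡⟨ ∸-+-assoc (A * N) (a * N) (c + d) ⟩
        A * N ∸ (a * N + (c + d))   ≡⟨ cong (A * N ∸_) (+-comm-middle (a * N) c d) ⟩
        A * N ∸ (c + (a * N + d))   ≡⟨ ∸-+-assoc (A * N) c (a * N + d) ⟨
        (A * N ∸ c) ∸ (a * N + d)   ∎
        where
        +-comm-middle : ∀ x c d → x + (c + d) ≡ c + (x + d)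
        +-comm-middle = solve-∀

-- The count matrix

module _ where

  open import Data.Nat using (_+_; _*_; _∸_; _^_; _!; _<_)
  open import Data.Nat.Properties
  open import Data.Nat.Combinatorics using (_C_; nCn≡1; k>n⇒nCk≡0)
  open import Data.Fin using (zero; suc; toℕ)
  open import Data.Integer as ℤ using (+_)
  import Data.Integer.Properties as ℤ
  open import Data.Nat.Tactic.RingSolver using (solve-∀)
  import Data.Integer.Tactic.RingSolver

  simplexMatrix : ℕ → ℕ → ℕ → ℕ → ℕ
  simplexMatrix k N j c = simplex k (suc j * N ∸ c)

  binomialMatrix : ℕ → ℕ → ℕ → ℕ
  binomialMatrix N j c = suc (suc j * N) C suc (suc c)

  det-count≡simplex : ∀ n N1 → det n ⟦ Tcount (suc n) (suc N1) ⟧ ≡ det n ⟦ simplexMatrix (suc n) (suc N1) ⟧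
  det-count≡simplex n N1 = sym (det-lowerUnitriangular ℓ (Tcount k N) (simplexMatrix k N) ℓ-diag ℓ-lower entries)
    where
    N k : ℕ
    N = suc N1
    k = suc n
    ℓ : ℕ → ℕ → ℕ
    ℓ j i = simplex k (suc j ∸ i)
    ℓ-diag : ∀ j → ℓ j j ≡ 1
    ℓ-diag j = trans (cong (simplex k) (trans (+-∸-assoc 1 (≤-refl {j})) (cong suc (n∸n≡0 j)))) (nCn≡1 k)
    ℓ-lower : ∀ j i → j < i → i < n → ℓ j i ≡ 0
    ℓ-lower j i j<i _ = cong (simplex k) (m≤n⇒m∸n≡0 j<i)
    entries : ∀ j c → j < n → c < n → simplexMatrix k N j c ≡ ∑ℕ[ i < n ] (ℓ j i * Tcount k N i c)
    entries j c j<n _ = sym (trans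
      (∑ℕ-fibres n (quotient N c) (ℓ j) (tuples k N) (λ i n≤i → cong (simplex k) (m≤n⇒m∸n≡0 (≤-trans j<n n≤i))))
      (simplex-tuples N k (suc j) c))

  det-simplex≡binomial : ∀ n N → det n ⟦ simplexMatrix (suc n) N ⟧ ≡ det n ⟦ binomialMatrix N ⟧
  det-simplex≡binomial n N = begin
    det n ⟦ simplexMatrix (suc n) N ⟧             ≡⟨ det-transpose {n} ⟦ simplexMatrix (suc n) N ⟧ ⟨
    det n ⟦ (λ c j → simplexMatrix (suc n) N j c) ⟧
      ≡⟨ det-upperUnitriangular ℓ (λ c j → binomialMatrix N j c) (λ c j → simplexMatrix (suc n) N j c)
           ℓ-diag ℓ-upper entries ⟩
    det n ⟦ (λ c j → binomialMatrix N j c) ⟧      ≡⟨ det-transpose {n} ⟦ binomialMatrix N ⟧ ⟩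
    det n ⟦ binomialMatrix N ⟧                    ∎
    where
    ℓ : ℕ → ℕ → ℕ
    ℓ c c″ = (n ∸ suc c) C (n ∸ suc c″)
    ℓ-diag : ∀ c → ℓ c c ≡ 1
    ℓ-diag c = nCn≡1 (n ∸ suc c)
    ℓ-upper : ∀ c c″ → c″ < c → c < n → ℓ c c″ ≡ 0
    ℓ-upper c c″ c″<c c<n = k>n⇒nCk≡0 (∸-monoʳ-< (s≤s c″<c) c<n)
    entries : ∀ c j → c < n → j < n → simplexMatrix (suc n) N j c ≡ ∑ℕ[ c″ < n ] (ℓ c c″ * binomialMatrix N j c″)
    entries c j c<n _ = begin
      simplex (suc n) (x ∸ c)
        ≡⟨ simplex-closedForm n x c c<n ⟩
      (suc x + a) C suc n
        ≡⟨ C-vandermonde (suc x) a (suc n) ⟩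
      (a C suc n) * 1 + ((a C n) * (suc x C 1) + ∑ℕ[ c″ < n ] (ℓ c c″ * (suc x C suc (suc c″))))
        ≡⟨ cong₂ (λ u v → u * 1 + (v * (suc x C 1) + ∑ℕ[ c″ < n ] (ℓ c c″ * (suc x C suc (suc c″)))))
             (k>n⇒nCk≡0 (m≤n⇒m≤1+n a<n)) (k>n⇒nCk≡0 a<n) ⟩
      ∑ℕ[ c″ < n ] (ℓ c c″ * binomialMatrix N j c″) ∎
      where
      x a : ℕ
      x = suc j * N
      a = n ∸ suc c
      a<n : a < n
      a<n = ∸-monoʳ-< (s≤s z≤n) c<n

  binomialGrid : ℕ → ℕ → ℕ → ℕ → ℕ
  binomialGrid N s j c = (s + j * N) C c

  det-binomialGrid-shift : ∀ n N s → det n ⟦ binomialGrid N (suc s) ⟧ ≡ det n ⟦ binomialGrid N s ⟧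
  det-binomialGrid-shift n N s = begin
    det n ⟦ binomialGrid N (suc s) ⟧
      ≡⟨ det-transpose {n} ⟦ binomialGrid N (suc s) ⟧ ⟨
    det n ⟦ (λ c j → binomialGrid N (suc s) j c) ⟧
      ≡⟨ det-lowerUnitriangular pascal (λ c j → binomialGrid N s j c) (λ c j → binomialGrid N (suc s) j c)
           pascal-diag pascal-lower entries ⟩
    det n ⟦ (λ c j → binomialGrid N s j c) ⟧
      ≡⟨ det-transpose {n} ⟦ binomialGrid N s ⟧ ⟩
    det n ⟦ binomialGrid N s ⟧ ∎
    where
    pascal : ℕ → ℕ → ℕ
    pascal c i = δ c i + δ c (suc i)
    pascal-diag : ∀ c → pascal c c ≡ 1
    pascal-diag c = cong₂ _+_ (δ-diag c) (δ-off (λ c≡1+c → <-irrefl c≡1+c (n<1+n c)))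
    pascal-lower : ∀ c i → c < i → i < n → pascal c i ≡ 0
    pascal-lower c i c<i _ = cong₂ _+_ (δ-off (<⇒≢ c<i)) (δ-off (<⇒≢ (m<n⇒m<1+n c<i)))
    entries : ∀ c j → c < n → j < n → binomialGrid N (suc s) j c ≡ ∑ℕ[ i < n ] (pascal c i * binomialGrid N s j i)
    entries c j c<n _ = sym (begin
      ∑ℕ[ i < n ] (pascal c i * f i)
        ≡⟨ ∑ℕ-cong n (λ i → *-distribʳ-+ (f i) (δ c i) (δ c (suc i))) ⟩
      ∑ℕ[ i < n ] (δ c i * f i + δ c (suc i) * f i)
        ≡⟨ ∑ℕ-distrib-+ n (λ i → δ c i * f i) (λ i → δ c (suc i) * f i) ⟩
      ∑ℕ[ i < n ] (δ c i * f i) + ∑ℕ[ i < n ] (δ c (suc i) * f i)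
        ≡⟨ cong (_+ ∑ℕ[ i < n ] (δ c (suc i) * f i)) (∑ℕ-δ n c f (λ n≤c → contradiction c<n (≤⇒≯ n≤c))) ⟩
      f c + ∑ℕ[ i < n ] (δ c (suc i) * f i)
        ≡⟨ previous c c<n ⟩
      suc y C c ∎)
      where
      y : ℕ
      y = s + j * N
      f : ℕ → ℕ
      f i = y C i
      previous : ∀ c → c < n → f c + ∑ℕ[ i < n ] (δ c (suc i) * f i) ≡ suc y C c
      previous zero    _   = cong suc (∑ℕ-zero n)
      previous (suc c) c<n = begin
        f (suc c) + ∑ℕ[ i < n ] (δ c i * f i)
          ≡⟨ cong (λ x → f (suc c) + x) (∑ℕ-δ n c f (λ n≤c → contradiction (<⇒≤ c<n) (≤⇒≯ n≤c))) ⟩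
        f (suc c) + f c
          ≡⟨ +-comm (f (suc c)) (f c) ⟩
        f c + f (suc c)
          ≡⟨ C-pascal y c ⟨
        suc y C suc c ∎

  det-binomialGrid₀ : ∀ n N1 → det n ⟦ binomialGrid (suc N1) 0 ⟧ ≡ + (suc N1 ^ (n C 2))
  det-binomialGrid  : ∀ n N1 s → det n ⟦ binomialGrid (suc N1) s ⟧ ≡ + (suc N1 ^ (n C 2))

  det-binomialGrid n N1 zero    = det-binomialGrid₀ n N1
  det-binomialGrid n N1 (suc s) = trans (det-binomialGrid-shift n (suc N1) s) (det-binomialGrid n N1 s)

  det-binomialGrid₀ zero    N1 = refl
  det-binomialGrid₀ (suc n) N1 = begin
    det (suc n) ⟦ binomialGrid N 0 ⟧
      ≡⟨ det-unitFirstRow {n} ⟦ binomialGrid N 0 ⟧ refl (λ c → refl) ⟩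
    det n ⟦ lower ⟧
      ≡⟨ ℤ.*-cancelˡ-≡ (+ (n !)) (det n ⟦ lower ⟧) (+ (N ^ (suc n C 2))) {{n !≢0}} scaled ⟩
    + (N ^ (suc n C 2)) ∎
    where
    N : ℕ
    N = suc N1
    lower : ℕ → ℕ → ℕ
    lower r c = suc r * N C suc c
    absorbed : ∀ r c → lower r c * suc c ≡ suc r * N * binomialGrid N N1 r c
    absorbed r c = trans (*-comm (lower r c) (suc c)) (C-absorb (N1 + r * N) c)
    scaled : + (n !) ℤ.* det n ⟦ lower ⟧ ≡ + (n !) ℤ.* + (N ^ (suc n C 2))
    scaled = begin
      + (n !) ℤ.* det n ⟦ lower ⟧
        ≡⟨ cong (λ p → + p ℤ.* det n ⟦ lower ⟧) (∏ℕ-suc n) ⟨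
      + ∏ℕ n suc ℤ.* det n ⟦ lower ⟧
        ≡⟨ det-scaleCols {n} suc ⟦ lower ⟧ ⟨
      det n (λ i j → ⟦ lower ⟧ i j ℤ.* + suc (toℕ j))
        ≡⟨ det-cong {n} (λ i j → trans (sym (ℤ.pos-* (lower (toℕ i) (toℕ j)) (suc (toℕ j))))
             (trans (cong +_ (absorbed (toℕ i) (toℕ j))) (ℤ.pos-* (suc (toℕ i) * N) _))) ⟩
      det n (λ i j → + (suc (toℕ i) * N) ℤ.* ⟦ binomialGrid N N1 ⟧ i j)
        ≡⟨ det-scaleRows {n} (λ r → suc r * N) ⟦ binomialGrid N N1 ⟧ ⟩
      + ∏ℕ[ r < n ] (suc r * N) ℤ.* det n ⟦ binomialGrid N N1 ⟧
        ≡⟨ cong₂ (λ p d → + p ℤ.* d) (∏ℕ-multiples n N) (det-binomialGrid n N1 N1) ⟩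
      + (n ! * N ^ n) ℤ.* + (N ^ (n C 2))
        ≡⟨ ℤ.pos-* (n ! * N ^ n) (N ^ (n C 2)) ⟨
      + (n ! * N ^ n * N ^ (n C 2))
        ≡⟨ cong +_ (trans (*-assoc (n !) (N ^ n) (N ^ (n C 2))) (cong (n ! *_) (^-choose2 N n))) ⟩
      + (n ! * N ^ (suc n C 2))
        ≡⟨ ℤ.pos-* (n !) (N ^ (suc n C 2)) ⟩
      + (n !) ℤ.* + (N ^ (suc n C 2)) ∎

  binomialMatrix-absorb : ∀ N1 j c → binomialMatrix (suc N1) j c * (suc c * suc (suc c)) ≡
    suc (suc j * suc N1) * (suc j * suc N1) * binomialGrid (suc N1) N1 j c
  binomialMatrix-absorb N1 j c = begin
    (suc (suc y) C suc (suc c)) * (suc c * suc (suc c))   ≡⟨ regroup (suc (suc y) C suc (suc c)) (suc c) (suc (suc c)) ⟩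
    suc c * (suc (suc c) * (suc (suc y) C suc (suc c)))   ≡⟨ cong (suc c *_) (C-absorb (suc y) (suc c)) ⟩
    suc c * (suc (suc y) * (suc y C suc c))               ≡⟨ swap (suc c) (suc (suc y)) (suc y C suc c) ⟩
    suc (suc y) * (suc c * (suc y C suc c))               ≡⟨ cong (suc (suc y) *_) (C-absorb y c) ⟩
    suc (suc y) * (suc y * (y C c))                       ≡⟨ *-assoc (suc (suc y)) (suc y) (y C c) ⟨
    suc (suc y) * suc y * (y C c)                         ∎
    where
    y : ℕ
    y = N1 + j * suc N1
    regroup : ∀ e a b → e * (a * b) ≡ a * (b * e)
    regroup = solve-∀
    swap : ∀ a b e → a * (b * e) ≡ b * (a * e)
    swap = solve-∀

  det-binomialMatrix-scaled : ∀ n N1 →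
    + ∏ℕ[ c < n ] (suc c * suc (suc c)) ℤ.* det n ⟦ binomialMatrix (suc N1) ⟧ ≡
    + (∏ℕ[ r < n ] (suc (suc r * suc N1) * (suc r * suc N1)) * suc N1 ^ (n C 2))
  det-binomialMatrix-scaled n N1 = begin
    + ∏ℕ n w ℤ.* det n ⟦ E ⟧
      ≡⟨ det-scaleCols {n} w ⟦ E ⟧ ⟨
    det n (λ i j → ⟦ E ⟧ i j ℤ.* + w (toℕ j))
      ≡⟨ det-cong {n} (λ i j → trans (sym (ℤ.pos-* (E (toℕ i) (toℕ j)) (w (toℕ j))))
           (trans (cong +_ (binomialMatrix-absorb N1 (toℕ i) (toℕ j)))
                  (ℤ.pos-* (v (toℕ i)) (binomialGrid N N1 (toℕ i) (toℕ j))))) ⟩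
    det n (λ i j → + v (toℕ i) ℤ.* ⟦ binomialGrid N N1 ⟧ i j)
      ≡⟨ det-scaleRows {n} v ⟦ binomialGrid N N1 ⟧ ⟩
    + ∏ℕ n v ℤ.* det n ⟦ binomialGrid N N1 ⟧
      ≡⟨ cong (λ d → + ∏ℕ n v ℤ.* d) (det-binomialGrid n N1 N1) ⟩
    + ∏ℕ n v ℤ.* + (N ^ (n C 2))
      ≡⟨ ℤ.pos-* (∏ℕ n v) (N ^ (n C 2)) ⟨
    + (∏ℕ n v * N ^ (n C 2)) ∎
    where
    N : ℕ
    N = suc N1
    E : ℕ → ℕ → ℕ
    E = binomialMatrix N
    v w : ℕ → ℕ
    v r = suc (suc r * N) * (suc r * N)
    w c = suc c * suc (suc c)

  det-binomialMatrix : ∀ n N1 → det n ⟦ binomialMatrix (suc N1) ⟧ ℤ.* + (suc n !) ≡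
    + (suc N1 ^ (suc n C 2) * ∏ℕ[ i < n ] (suc i * suc N1 + 1))
  det-binomialMatrix n N1 = ℤ.*-cancelˡ-≡ (+ (n !)) (D ℤ.* + (suc n !)) (+ (N ^ (suc n C 2) * P)) {{n !≢0}} (begin
    + (n !) ℤ.* (D ℤ.* + (suc n !))
      ≡⟨ ℤ-regroup (+ (n !)) D (+ (suc n !)) ⟩
    + (n !) ℤ.* + (suc n !) ℤ.* D
      ≡⟨ cong (ℤ._* D) (trans (sym (ℤ.pos-* (n !) (suc n !))) (cong +_ (sym (∏ℕ-consecutive n)))) ⟩
    + ∏ℕ[ c < n ] (suc c * suc (suc c)) ℤ.* D
      ≡⟨ det-binomialMatrix-scaled n N1 ⟩
    + (∏ℕ[ r < n ] (suc (suc r * N) * (suc r * N)) * N ^ (n C 2))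
      ≡⟨ cong +_ products ⟩
    + (n ! * (N ^ (suc n C 2) * P))
      ≡⟨ ℤ.pos-* (n !) (N ^ (suc n C 2) * P) ⟩
    + (n !) ℤ.* + (N ^ (suc n C 2) * P) ∎)
    where
    N P : ℕ
    N = suc N1
    P = ∏ℕ[ i < n ] (suc i * N + 1)
    D : ℤ.ℤ
    D = det n ⟦ binomialMatrix N ⟧
    ℤ-regroup : ∀ a d b → a ℤ.* (d ℤ.* b) ≡ a ℤ.* b ℤ.* d
    ℤ-regroup = Data.Integer.Tactic.RingSolver.solve-∀
    regroup : ∀ p f a b → p * (f * a) * b ≡ f * (a * b * p)
    regroup = solve-∀
    products : ∏ℕ[ r < n ] (suc (suc r * N) * (suc r * N)) * N ^ (n C 2) ≡ n ! * (N ^ (suc n C 2) * P)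
    products = begin
      ∏ℕ[ r < n ] (suc (suc r * N) * (suc r * N)) * N ^ (n C 2)
        ≡⟨ cong (_* N ^ (n C 2)) (∏ℕ-distrib-* n (λ r → suc (suc r * N)) (λ r → suc r * N)) ⟩
      ∏ℕ[ r < n ] suc (suc r * N) * ∏ℕ[ r < n ] (suc r * N) * N ^ (n C 2)
        ≡⟨ cong₂ (λ p q → p * q * N ^ (n C 2)) (∏ℕ-cong n (λ r → +-comm 1 (suc r * N))) (∏ℕ-multiples n N) ⟩
      P * (n ! * N ^ n) * N ^ (n C 2)
        ≡⟨ regroup P (n !) (N ^ n) (N ^ (n C 2)) ⟩
      n ! * (N ^ n * N ^ (n C 2) * P)
        ≡⟨ cong (λ e → n ! * (e * P)) (^-choose2 N n) ⟩
      n ! * (N ^ (suc n C 2) * P) ∎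

  det-countMatrix : ∀ n N1 → det n ⟦ Tcount (suc n) (suc N1) ⟧ ℤ.* + (suc n !) ≡
    + (suc N1 ^ (suc n C 2) * ∏ℕ[ i < n ] (suc i * suc N1 + 1))
  det-countMatrix n N1 = begin
    det n ⟦ Tcount (suc n) (suc N1) ⟧ ℤ.* + (suc n !)          ≡⟨ cong (ℤ._* + (suc n !)) (det-count≡simplex n N1) ⟩
    det n ⟦ simplexMatrix (suc n) (suc N1) ⟧ ℤ.* + (suc n !)   ≡⟨ cong (ℤ._* + (suc n !)) (det-simplex≡binomial n (suc N1)) ⟩
    det n ⟦ binomialMatrix (suc N1) ⟧ ℤ.* + (suc n !)          ≡⟨ det-binomialMatrix n N1 ⟩
    + (suc N1 ^ (suc n C 2) * ∏ℕ[ i < n ] (suc i * suc N1 + 1)) ∎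

open import Data.Nat using (ℕ; _≤_; _^_; _*_; _!; s≤s; z≤n; >-nonZero)
open import Data.Nat.Properties using (≤-trans)
open import Data.Nat.Combinatorics using (_C_)
open import Data.Integer as ℤ using (ℤ; +_)
open import Relation.Binary.PropositionalEquality using (_≡_)
open import Data.List.Properties using (map-upTo)
open import Data.Nat.ListAction using (product)

corollary5p4 : (k N : ℕ) → 2 ≤ k → (hN : 2 ≤ N) →
    det (Data.Nat._∸_ k 1) (Ttilde k N {{>-nonZero (≤-trans (s≤s z≤n) hN)}}) ℤ.* (+ (k !))
      ≡ + (N ^ (k C 2) * prodTerm k N)
-- The hypotheses are only needed to exclude k = 0 and N = 0.
corollary5p4 (suc n) (suc N1) _ _ = begin
  det n ⟦ Tcount (suc n) (suc N1) ⟧ ℤ.* + (suc n !)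
    ≡⟨ det-countMatrix n N1 ⟩
  + (suc N1 ^ (suc n C 2) * ∏ℕ[ i < n ] (suc i * suc N1 ℕ.+ 1))
    ≡⟨ cong (λ xs → + (suc N1 ^ (suc n C 2) * product xs)) (map-upTo (λ i → suc i * suc N1 ℕ.+ 1) n) ⟨
  + (suc N1 ^ (suc n C 2) * prodTerm (suc n) (suc N1)) ∎
corollary5p4 zero    N      ()  _
corollary5p4 (suc n) zero   _   ()
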